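{- Let $n$ be a positive integer with $n\equiv0$ or $3\pmod5$ and $n\equiv1\pmod6$, and let $H$ be any abelian group of order $n^2+n+1$. Then there are no inverse-closed subsets $T_0,T_1\subseteq H$ with $e\in T_0$ satisfying $T_0T_1=H-e$ and $T_0^2+T_1^2=2H-T_0^{(2)}-T_1^{(2)}+2ne$ in $\mathbb{Z}[H]$.
   Context: $H$ is written multiplicatively with identity $e$; $\mathbb{Z}[H]$ is the integral group ring, a subset $D\subseteq H$ is identified with $\sum_{g\in D}g$, and $H$ also denotes $\sum_{h\in H}h$. For $A=\sum a_gg$ and $t\in\mathbb{Z}$, $A^{(t)}=\sum a_gg^t$. Inverse-closed means $T^{(-1)}=T$. -}

module Defs where

open import Level using (0ℓ)
open import Data.Bool using (Bool; true; false; if_then_else_)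
open import Data.Nat as ℕ using (ℕ)
open import Data.Integer as ℤ using (ℤ; +_; _+_; _-_; _*_)
open import Data.List using (List; length; map; foldr)
open import Data.List.Membership.Propositional using (_∈_)
open import Data.List.Relation.Unary.Unique.Propositional using (Unique)
open import Relation.Binary.PropositionalEquality using (_≡_)
open import Relation.Binary.Definitions using (DecidableEquality)
open import Relation.Nullary.Decidable using (does)
open import Algebra.Structures using (IsAbelianGroup)

record FiniteAbelianGroup : Set₁ where
  field
    Carrier        : Set
    _∙_            : Carrier → Carrier → Carrier
    ε              : Carrier
    _⁻¹            : Carrier → Carrier
    isAbelianGroup : IsAbelianGroup _≡_ _∙_ ε _⁻¹
    _≟_            : DecidableEquality Carrier
    elements       : List Carrier
    complete       : ∀ x → x ∈ elements
    unique         : Unique elements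

  order : ℕ
  order = length elements

  GroupRing : Set
  GroupRing = Carrier → ℤ

  sumH : (Carrier → ℤ) → ℤ
  sumH f = foldr (λ h acc → f h + acc) (+ 0) elements

  Subset : Set
  Subset = Carrier → Bool

  -- A subset D identified with Σ_{g ∈ D} g
  ⟦_⟧ : Subset → GroupRing
  ⟦ D ⟧ g = if D g then + 1 else + 0

  eR : GroupRing
  eR g = if does (g ≟ ε) then + 1 else + 0

  HR : GroupRing
  HR g = + 1

  _·_ : GroupRing → GroupRing → GroupRing
  (A · B) g = sumH (λ h → A h * B ((h ⁻¹) ∙ g))

  -- A^{(2)} = Σ a_h h², coefficient at g is Σ_{h : h² = g} a_h
  _⁽²⁾ : GroupRing → GroupRing
  (A ⁽²⁾) g = sumH (λ h → if does ((h ∙ h) ≟ g) then A h else + 0)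

  InverseClosed : Subset → Set
  InverseClosed T = ∀ g → T (g ⁻¹) ≡ T g

module Submission where

-- As n ≡ 1 (mod 6), |H| = 3 m with m ≡ 1 (mod 3). By Cauchy H contains an element z of order 3,
-- and as 9 does not divide |H| every element of order dividing 3 is a power of z; hence g ↦ g ^ m
-- maps H homomorphically onto ⟨ z ⟩ ≅ ℤ₃. Pushing both group ring equations forward to ℤ[ℤ₃]
-- and writing the images of T₀, T₁ as x₀ + x₁ (ω + ω²), y₀ + y₁ (ω + ω²) (they are inverse-closed),
-- the coefficients at 1 and ω give u v = -1 and u² + v² = 2 n - u - v for u = x₀ - x₁,
-- v = y₀ - y₁. So {u, v} = {1, -1} and n = 1, contradicting n ≡ 0 or 3 (mod 5).

open import Defs
open import Level using (0ℓ)
open import Function using (id; _∘_; _∘′_)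
open import Function.Bundles using (mk⇔)
open import Algebra.Bundles using (CommutativeMonoid; AbelianGroup)
open import Algebra.Structures using (IsCommutativeMonoid)
import Algebra.Properties.CommutativeMonoid.Mult
open import Data.Bool using (true; false; if_then_else_)
open import Data.Empty using (⊥-elim)
open import Data.Unit using (⊤)
open import Data.Product using (Σ; ∃; _×_; _,_; proj₁; proj₂)
open import Data.Product.Properties using (≡-dec)
open import Data.Sum using (_⊎_; inj₁; inj₂)
open import Data.Nat as ℕ using (ℕ; zero; suc; _%_; _/_; _>_)
import Data.Nat.Properties as ℕ
open import Data.Nat.DivMod using (m≡m%n+[m/n]*n)
open import Data.Nat.Divisibility
  using (_∣_; _∣?_; divides; _∣0; ∣-refl; ∣-trans; ∣m∣n⇒∣m+n; ∣m+n∣m⇒∣n; m∣m*n; n∣m*n)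
import Data.Nat.Tactic.RingSolver as ℕ-Solver
open import Data.Integer as ℤ using (ℤ; +_; -[1+_]; ∣_∣; -1ℤ)
import Data.Integer.Properties as ℤ
open import Data.Integer.Tactic.RingSolver using (solve-∀)
open import Data.Fin using (Fin; zero; suc; toℕ)
import Data.Fin.Properties as Fin
open import Data.List using (List; []; _∷_; length; map; foldr; filter; allFin; cartesianProduct)
import Data.List.Properties as List
open import Data.List.Membership.Propositional using (_∈_)
import Data.List.Membership.Propositional.Properties as Membership
open import Data.List.Membership.Propositional.Properties.WithK using (unique∧set⇒bag)
open import Data.List.Relation.Unary.Any using (here; there; any?)
import Data.List.Relation.Unary.Any as Any
open import Data.List.Relation.Unary.All using (All; []; _∷_)
import Data.List.Relation.Unary.All as All
open import Data.List.Relation.Unary.AllPairs using ([]; _∷_)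
open import Data.List.Relation.Unary.Unique.Propositional using (Unique)
import Data.List.Relation.Unary.Unique.Propositional.Properties as Unique
open import Data.List.Relation.Binary.Permutation.Propositional using (_↭_; ↭⇒↭ₛ)
import Data.List.Relation.Binary.Permutation.Propositional.Properties as Perm
import Data.List.Relation.Binary.Permutation.Setoid.Properties as PermₛProperties
open import Data.List.Relation.Binary.BagAndSetEquality using (∼bag⇒↭)
open import Relation.Binary.Definitions using (DecidableEquality)
open import Relation.Binary.PropositionalEquality
open import Relation.Nullary using (¬_; yes; no; ¬?; does)
open import Relation.Nullary.Decidable using (_×-dec_; toWitnessFalse)
open import Relation.Unary as U using ()
open import Relation.Unary.Properties using (∁?)

private variable
  X Y : Set

↭-unique : {xs ys : List X} → Unique xs → Unique ys →
           (∀ {x} → x ∈ xs → x ∈ ys) → (∀ {x} → x ∈ ys → x ∈ xs) → xs ↭ ys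
↭-unique uxs uys to from = ∼bag⇒↭ (unique∧set⇒bag uxs uys (mk⇔ to from))

module ListSum {A : Set} {_⊕_ : A → A → A} {ε : A}
  (isCommutativeMonoid : IsCommutativeMonoid _≡_ _⊕_ ε) where

  monoid : CommutativeMonoid 0ℓ 0ℓ
  monoid = record { isCommutativeMonoid = isCommutativeMonoid }

  open CommutativeMonoid monoid using (identityˡ; identityʳ)
  open import Algebra.Properties.CommutativeSemigroup (CommutativeMonoid.commutativeSemigroup monoid)
    using (interchange)
  module Mult = Algebra.Properties.CommutativeMonoid.Mult monoid

  sum : List X → (X → A) → A
  sum xs f = foldr (λ x acc → f x ⊕ acc) ε xs

  sum-cong : ∀ xs {f g : X → A} → (∀ x → f x ≡ g x) → sum xs f ≡ sum xs g
  sum-cong []       f≗g = refl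
  sum-cong (x ∷ xs) f≗g = cong₂ _⊕_ (f≗g x) (sum-cong xs f≗g)

  sum-zero : ∀ xs {f : X → A} → (∀ {x} → x ∈ xs → f x ≡ ε) → sum xs f ≡ ε
  sum-zero []       f≡ε = refl
  sum-zero (x ∷ xs) f≡ε =
    trans (cong₂ _⊕_ (f≡ε (here refl)) (sum-zero xs (f≡ε ∘′ there))) (identityˡ ε)

  sum-distrib : ∀ xs (f g : X → A) → sum xs (λ x → f x ⊕ g x) ≡ sum xs f ⊕ sum xs g
  sum-distrib []       f g = sym (identityˡ ε)
  sum-distrib (x ∷ xs) f g =
    trans (cong ((f x ⊕ g x) ⊕_) (sum-distrib xs f g)) (interchange (f x) (g x) _ _)

  sum-swap : ∀ xs ys (f : X → Y → A) →
             sum xs (λ x → sum ys (f x)) ≡ sum ys (λ y → sum xs (λ x → f x y))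
  sum-swap []       ys f = sym (sum-zero ys (λ _ → refl))
  sum-swap (x ∷ xs) ys f =
    trans (cong (sum ys (f x) ⊕_) (sum-swap xs ys f)) (sym (sum-distrib ys (f x) _))

  sum-map : ∀ (φ : X → Y) xs (f : Y → A) → sum (map φ xs) f ≡ sum xs (λ x → f (φ x))
  sum-map φ []       f = refl
  sum-map φ (x ∷ xs) f = cong (f (φ x) ⊕_) (sum-map φ xs f)

  sum-↭ : ∀ {xs ys} → xs ↭ ys → (f : X → A) → sum xs f ≡ sum ys f
  sum-↭ {xs = xs} {ys} xs↭ys f = begin
    sum xs f               ≡⟨ List.foldr-map _⊕_ f ε xs ⟨
    foldr _⊕_ ε (map f xs) ≡⟨ foldr-commMonoid isCommutativeMonoid (↭⇒↭ₛ (Perm.map⁺ f xs↭ys)) ⟩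
    foldr _⊕_ ε (map f ys) ≡⟨ List.foldr-map _⊕_ f ε ys ⟩
    sum ys f               ∎
    where
      open ≡-Reasoning
      open PermₛProperties (setoid A) using (foldr-commMonoid)

  sum-const : ∀ (xs : List X) c → sum xs (λ _ → c) ≡ length xs Mult.× c
  sum-const []       c = refl
  sum-const (x ∷ xs) c = cong (c ⊕_) (sum-const xs c)

  sum-single : ∀ {xs} {f : X → A} {x} → Unique xs → x ∈ xs →
               (∀ y → y ≢ x → f y ≡ ε) → sum xs f ≡ f x
  sum-single {xs = _ ∷ ys} {f} (x∉ys ∷ _) (here refl) f≡ε =
    trans (cong (f _ ⊕_) (sum-zero ys (λ y∈ys → f≡ε _ (All.lookup x∉ys y∈ys ∘ sym))))
          (identityʳ _)
  sum-single (y∉ys ∷ uys) (there x∈ys) f≡ε =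
    trans (cong₂ _⊕_ (f≡ε _ (All.lookup y∉ys x∈ys)) (sum-single uys x∈ys f≡ε)) (identityˡ _)

  sum-reindex : ∀ {els : List X} → Unique els → (∀ x → x ∈ els) →
                (φ ψ : X → X) → (∀ x → ψ (φ x) ≡ x) → (∀ x → φ (ψ x) ≡ x) →
                (f : X → A) → sum els (λ x → f (φ x)) ≡ sum els f
  sum-reindex {els = els} uels complete φ ψ ψφ φψ f =
    trans (sym (sum-map φ els f)) (sum-↭ (↭-unique (Unique.map⁺ φ-injective uels) uels
            (λ _ → complete _)
            (λ {y} _ → subst (_∈ map φ els) (φψ y) (Membership.∈-map⁺ φ (complete (ψ y)))))
          f)
    where
      φ-injective : ∀ {x y} → φ x ≡ φ y → x ≡ y
      φ-injective {x} {y} eq = trans (sym (ψφ x)) (trans (cong ψ eq) (ψφ y))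

length-filter-split : ∀ {P : X → Set} (P? : U.Decidable P) xs →
                      length xs ≡ length (filter P? xs) ℕ.+ length (filter (∁? P?) xs)
length-filter-split P? []       = refl
length-filter-split P? (x ∷ xs) with P? x
... | yes _ = cong suc (length-filter-split P? xs)
... | no  _ = trans (cong suc (length-filter-split P? xs)) (sym (ℕ.+-suc _ _))

length-cartesianProduct : ∀ (xs : List X) (ys : List Y) →
                          length (cartesianProduct xs ys) ≡ length xs ℕ.* length ys
length-cartesianProduct []       ys = refl
length-cartesianProduct (x ∷ xs) ys =
  trans (List.length-++ (map (x ,_) ys))
        (cong₂ ℕ._+_ (List.length-map (x ,_) ys) (length-cartesianProduct xs ys))

module Blocks {X : Set} (_≟_ : DecidableEquality X) {P : X → Set} (B : X → List X) (d : ℕ)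
  (B-unique : ∀ {x} → P x → Unique (B x))
  (B-length : ∀ {x} → P x → length (B x) ≡ d)
  (B-refl   : ∀ x → x ∈ B x)
  (B-sym    : ∀ {x y} → P x → y ∈ B x → x ∈ B y)
  (B-trans  : ∀ {x y u} → P x → P y → y ∈ B x → u ∈ B y → u ∈ B x) where

  open import Data.List.Membership.DecPropositional _≟_ using (_∈?_)

  BlockClosed : List X → Set
  BlockClosed xs = ∀ {x u} → x ∈ xs → u ∈ B x → u ∈ xs

  blocks-divide : ∀ xs → Unique xs → All P xs → BlockClosed xs → d ∣ length xs
  blocks-divide xs = go (length xs) xs ℕ.≤-refl
    where
    go : ∀ k xs → length xs ℕ.≤ k → Unique xs → All P xs → BlockClosed xs → d ∣ length xs
    go _       []       _              _    _   _      = d ∣0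
    go (suc k) (x ∷ xs) (ℕ.s≤s |xs|≤k) uxxs pxxs closed =
      subst (d ∣_) (sym (length-filter-split (_∈? B x) (x ∷ xs)))
            (∣m∣n⇒∣m+n (subst (d ∣_) (sym |block|≡d) ∣-refl) (go k rest |rest|≤k urest prest crest))
      where
        px = All.lookup pxxs (here refl)
        block = filter (_∈? B x) (x ∷ xs)
        rest  = filter (∁? (_∈? B x)) (x ∷ xs)

        |block|≡d : length block ≡ d
        |block|≡d = trans (Perm.↭-length (↭-unique (Unique.filter⁺ (_∈? B x) uxxs) (B-unique px)
                              (λ u∈ → proj₂ (Membership.∈-filter⁻ (_∈? B x) u∈))
                              (λ u∈ → Membership.∈-filter⁺ (_∈? B x) (closed (here refl) u∈) u∈)))
                          (B-length px)

        |rest|≤k : length rest ℕ.≤ k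
        |rest|≤k = subst (λ l → length l ℕ.≤ k)
                         (sym (List.filter-reject (∁? (_∈? B x)) (λ x∉ → x∉ (B-refl x))))
                         (ℕ.≤-trans (List.length-filter (∁? (_∈? B x)) xs) |xs|≤k)

        urest : Unique rest
        urest = Unique.filter⁺ (∁? (_∈? B x)) uxxs

        prest : All P rest
        prest = All.tabulate (λ u∈ → All.lookup pxxs (proj₁ (Membership.∈-filter⁻ (∁? (_∈? B x)) u∈)))

        crest : BlockClosed rest
        crest {y} {u} y∈ u∈By with Membership.∈-filter⁻ (∁? (_∈? B x)) y∈
        ... | y∈xxs , y∉Bx = Membership.∈-filter⁺ (∁? (_∈? B x)) u∈xxs
                               (λ u∈Bx → y∉Bx (B-trans px (All.lookup pxxs u∈xxs) u∈Bx
                                                 (B-sym (All.lookup pxxs y∈xxs) u∈By)))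
          where u∈xxs = closed y∈xxs u∈By

module Orbits₃ {X : Set} (_≟_ : DecidableEquality X) (σ : X → X) (σ³≡id : ∀ x → σ (σ (σ x)) ≡ x) where

  orbit : X → List X
  orbit x = x ∷ σ x ∷ σ (σ x) ∷ []

  σ-orbit : ∀ {x u} → u ∈ orbit x → σ u ∈ orbit x
  σ-orbit (here refl)                = there (here refl)
  σ-orbit (there (here refl))        = there (there (here refl))
  σ-orbit {x} (there (there (here refl))) = here (σ³≡id x)

  orbit-trans : ∀ {x y u} → y ∈ orbit x → u ∈ orbit y → u ∈ orbit x
  orbit-trans y∈ (here refl)                = y∈
  orbit-trans y∈ (there (here refl))        = σ-orbit y∈
  orbit-trans y∈ (there (there (here refl))) = σ-orbit (σ-orbit y∈)

  orbit-sym : ∀ {x y} → y ∈ orbit x → x ∈ orbit y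
  orbit-sym     (here refl)                = here refl
  orbit-sym {x} (there (here refl))        = there (there (here (sym (σ³≡id x))))
  orbit-sym {x} (there (there (here refl))) = there (here (sym (σ³≡id x)))

  orbit-unique : ∀ {x} → σ x ≢ x → Unique (orbit x)
  orbit-unique {x} σx≢x = (x≢σx ∷ x≢σ²x ∷ []) ∷ (σx≢σ²x ∷ []) ∷ [] ∷ []
    where
      x≢σx : x ≢ σ x
      x≢σx = σx≢x ∘ sym
      x≢σ²x : x ≢ σ (σ x)
      x≢σ²x eq = σx≢x (trans (cong σ eq) (σ³≡id x))
      σx≢σ²x : σ x ≢ σ (σ x)
      σx≢σ²x eq = x≢σx (trans (sym (σ³≡id x)) (trans (cong (σ ∘ σ) eq) (σ³≡id (σ x))))

  orbits-divide : ∀ xs → Unique xs → (∀ {x} → x ∈ xs → σ x ∈ xs) → (∀ {x} → x ∈ xs → σ x ≢ x) →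
                  3 ∣ length xs
  orbits-divide xs uxs σ-closed moved =
    Blocks.blocks-divide _≟_ {P = λ x → σ x ≢ x} orbit 3 orbit-unique (λ _ → refl) (λ _ → here refl)
      (λ _ → orbit-sym) (λ _ _ → orbit-trans) xs uxs (All.tabulate moved) orbit-closed
    where
      orbit-closed : ∀ {x u} → x ∈ xs → u ∈ orbit x → u ∈ xs
      orbit-closed x∈ (here refl)                = x∈
      orbit-closed x∈ (there (here refl))        = σ-closed x∈
      orbit-closed x∈ (there (there (here refl))) = σ-closed (σ-closed x∈)

  one-fixed-point⇒3∤ : ∀ xs {x₀} → Unique xs → x₀ ∈ xs → σ x₀ ≡ x₀ → (∀ {x} → x ∈ xs → σ x ∈ xs) →
                       (∀ {x} → x ∈ xs → σ x ≡ x → x ≡ x₀) → ¬ 3 ∣ length xs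
  one-fixed-point⇒3∤ xs {x₀} uxs x₀∈ σx₀≡x₀ σ-closed fixed⇒x₀ 3∣|xs| =
    toWitnessFalse {a? = 3 ∣? 1} _ (∣m+n∣m⇒∣n 3∣|moved|+1 3∣|moved|)
    where
      ≟x₀ = λ x → x ≟ x₀
      moved = filter (∁? ≟x₀) xs

      σ-moved : ∀ {x} → x ∈ moved → σ x ∈ moved
      σ-moved x∈ with Membership.∈-filter⁻ (∁? ≟x₀) {xs = xs} x∈
      ... | x∈xs , x≢x₀ = Membership.∈-filter⁺ (∁? ≟x₀) (σ-closed x∈xs) (λ σx≡x₀ →
                            x≢x₀ (trans (sym (σ³≡id _)) (trans (cong (σ ∘ σ) σx≡x₀)
                                                           (trans (cong σ σx₀≡x₀) σx₀≡x₀))))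

      3∣|moved| : 3 ∣ length moved
      3∣|moved| = orbits-divide moved (Unique.filter⁺ (∁? ≟x₀) uxs) σ-moved
        (λ x∈ σx≡x → proj₂ (Membership.∈-filter⁻ (∁? ≟x₀) {xs = xs} x∈)
                       (fixed⇒x₀ (proj₁ (Membership.∈-filter⁻ (∁? ≟x₀) {xs = xs} x∈)) σx≡x))

      |fixed|≡1 : length (filter ≟x₀ xs) ≡ 1
      |fixed|≡1 = Perm.↭-length (↭-unique (Unique.filter⁺ ≟x₀ uxs) ([] ∷ [])
                    (λ x∈ → here (proj₂ (Membership.∈-filter⁻ ≟x₀ {xs = xs} x∈)))
                    (λ { (here refl) → Membership.∈-filter⁺ ≟x₀ x₀∈ refl }))

      3∣|moved|+1 : 3 ∣ length moved ℕ.+ 1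
      3∣|moved|+1 = subst (3 ∣_) (trans (length-filter-split ≟x₀ xs)
                                        (trans (cong (ℕ._+ length moved) |fixed|≡1) (ℕ.+-comm 1 _)))
                          3∣|xs|

module IntSum where
  open import Data.Integer using (_+_; _*_; -_)
  open ListSum ℤ.+-0-isCommutativeMonoid public

  sum-*ˡ : ∀ c xs (f : X → ℤ) → sum xs (λ x → c * f x) ≡ c * sum xs f
  sum-*ˡ c []       f = sym (ℤ.*-zeroʳ c)
  sum-*ˡ c (x ∷ xs) f = trans (cong (_+_ (c * f x)) (sum-*ˡ c xs f)) (sym (ℤ.*-distribˡ-+ c (f x) _))

  sum-*ʳ : ∀ c xs (f : X → ℤ) → sum xs (λ x → f x * c) ≡ sum xs f * c
  sum-*ʳ c xs f = trans (sum-cong xs (λ x → ℤ.*-comm (f x) c))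
                        (trans (sum-*ˡ c xs f) (ℤ.*-comm c _))

  sum-neg : ∀ xs (f : X → ℤ) → sum xs (λ x → - f x) ≡ - sum xs f
  sum-neg []       f = refl
  sum-neg (x ∷ xs) f = trans (cong (_+_ (- f x)) (sum-neg xs f)) (sym (ℤ.neg-distrib-+ (f x) _))

module _ (G K : FiniteAbelianGroup) where
  private
    module G = FiniteAbelianGroup G
    module K = FiniteAbelianGroup K

  IsHom : (G.Carrier → K.Carrier) → Set
  IsHom φ = ∀ x y → φ (x G.∙ y) ≡ φ x K.∙ φ y

pattern 0₃ = zero
pattern 1₃ = suc zero
pattern 2₃ = suc (suc zero)

rot₃ : Fin 3 → Fin 3
rot₃ 0₃ = 1₃
rot₃ 1₃ = 2₃
rot₃ 2₃ = 0₃

infixl 20 _+₃_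
_+₃_ : Fin 3 → Fin 3 → Fin 3
0₃ +₃ b = b
1₃ +₃ b = rot₃ b
2₃ +₃ b = rot₃ (rot₃ b)

infix 25 -₃_
-₃_ : Fin 3 → Fin 3
-₃ 0₃ = 0₃
-₃ 1₃ = 2₃
-₃ 2₃ = 1₃

rot₃³ : ∀ a → rot₃ (rot₃ (rot₃ a)) ≡ a
rot₃³ 0₃ = refl
rot₃³ 1₃ = refl
rot₃³ 2₃ = refl

rot₃-+ˡ : ∀ a b → rot₃ a +₃ b ≡ rot₃ (a +₃ b)
rot₃-+ˡ 0₃ b = refl
rot₃-+ˡ 1₃ b = refl
rot₃-+ˡ 2₃ b = sym (rot₃³ b)

rot₃-+ʳ : ∀ a b → a +₃ rot₃ b ≡ rot₃ (a +₃ b)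
rot₃-+ʳ 0₃ b = refl
rot₃-+ʳ 1₃ b = refl
rot₃-+ʳ 2₃ b = refl

+₃-identityʳ : ∀ a → a +₃ 0₃ ≡ a
+₃-identityʳ 0₃ = refl
+₃-identityʳ 1₃ = refl
+₃-identityʳ 2₃ = refl

+₃-assoc : ∀ a b c → a +₃ b +₃ c ≡ a +₃ (b +₃ c)
+₃-assoc 0₃ b c = refl
+₃-assoc 1₃ b c = rot₃-+ˡ b c
+₃-assoc 2₃ b c = trans (rot₃-+ˡ (rot₃ b) c) (cong rot₃ (rot₃-+ˡ b c))

+₃-comm : ∀ a b → a +₃ b ≡ b +₃ a
+₃-comm a 0₃ = +₃-identityʳ a
+₃-comm a 1₃ = trans (rot₃-+ʳ a 0₃) (cong rot₃ (+₃-identityʳ a))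
+₃-comm a 2₃ = trans (rot₃-+ʳ a 1₃) (cong rot₃ (+₃-comm a 1₃))

+₃-inverseˡ : ∀ a → -₃ a +₃ a ≡ 0₃
+₃-inverseˡ 0₃ = refl
+₃-inverseˡ 1₃ = refl
+₃-inverseˡ 2₃ = refl

+₃-inverseʳ : ∀ a → a +₃ -₃ a ≡ 0₃
+₃-inverseʳ 0₃ = refl
+₃-inverseʳ 1₃ = refl
+₃-inverseʳ 2₃ = refl

ℤ₃ : FiniteAbelianGroup
ℤ₃ = record
  { Carrier        = Fin 3
  ; _∙_            = _+₃_
  ; ε              = 0₃
  ; _⁻¹            = -₃_
  ; isAbelianGroup = record
    { isGroup = record
      { isMonoid = record
        { isSemigroup = record
          { isMagma = record { isEquivalence = isEquivalence ; ∙-cong = cong₂ _+₃_ }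
          ; assoc   = +₃-assoc }
        ; identity = (λ _ → refl) , +₃-identityʳ }
      ; inverse = +₃-inverseˡ , +₃-inverseʳ
      ; ⁻¹-cong = cong -₃_ }
    ; comm = +₃-comm }
  ; _≟_      = Fin._≟_
  ; elements = allFin 3
  ; complete = Membership.∈-allFin
  ; unique   = Unique.allFin⁺ 3
  }

-- The bundle's _∙_ and _⁻¹ are those of G, but come with fixity declarations.
module GroupFacts (G : FiniteAbelianGroup) where
  open FiniteAbelianGroup G hiding (_∙_; _⁻¹)

  abelianGroup : AbelianGroup 0ℓ 0ℓ
  abelianGroup = record { isAbelianGroup = isAbelianGroup }

  open AbelianGroup abelianGroup public
    using (_∙_; _⁻¹; group; commutativeMonoid; isCommutativeMonoid;
           assoc; comm; identityˡ; identityʳ; inverseˡ; inverseʳ)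
  open import Algebra.Properties.Group group public
  open import Algebra.Properties.CommutativeSemigroup
    (AbelianGroup.commutativeSemigroup abelianGroup) public using (interchange)
  module Mult = Algebra.Properties.CommutativeMonoid.Mult commutativeMonoid
  module Product = ListSum isCommutativeMonoid

  infixr 30 _^_
  _^_ : Carrier → ℕ → Carrier
  g ^ k = k Mult.× g

  ^-* : ∀ g j k → (g ^ j) ^ k ≡ g ^ (k ℕ.* j)
  ^-* g j k = Mult.×-assocˡ g k j

  ^-∙ : ∀ g h k → (g ∙ h) ^ k ≡ g ^ k ∙ h ^ k
  ^-∙ g h k = Mult.×-distrib-+ g h k

  ε^ : ∀ k → ε ^ k ≡ ε
  ε^ zero    = refl
  ε^ (suc k) = trans (identityˡ _) (ε^ k)

  -- Translating the product of all elements by g multiplies it by g ^ order.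
  ^-order : ∀ g → g ^ order ≡ ε
  ^-order g = ∙-cancelʳ Π (g ^ order) ε (begin
    g ^ order ∙ Π                          ≡⟨ cong (_∙ Π) (Product.sum-const elements g) ⟨
    Product.sum elements (λ _ → g) ∙ Π     ≡⟨ Product.sum-distrib elements (λ _ → g) id ⟨
    Product.sum elements (λ h → g ∙ h)     ≡⟨ Product.sum-reindex unique complete (g ∙_) (g ⁻¹ ∙_)
                                                      (\\-leftDividesʳ g) (\\-leftDividesˡ g) id ⟩
    Π                                          ≡⟨ identityˡ Π ⟨
    ε ∙ Π                                      ∎)
    where
      open ≡-Reasoning
      Π = Product.sum elements id

  infixr 30 _^₃_
  _^₃_ : Carrier → Fin 3 → Carrier
  c ^₃ i = c ^ toℕ i

  infix 4 _∈⟨_⟩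
  _∈⟨_⟩ : Carrier → Carrier → Set
  x ∈⟨ c ⟩ = ∃ λ i → x ≡ c ^₃ i

  ^₃-rot : ∀ {c} → c ^ 3 ≡ ε → ∀ i → c ^₃ rot₃ i ≡ c ∙ c ^₃ i
  ^₃-rot c³≡ε 0₃ = refl
  ^₃-rot c³≡ε 1₃ = refl
  ^₃-rot c³≡ε 2₃ = sym c³≡ε

  ^₃-hom : ∀ {c} → c ^ 3 ≡ ε → IsHom ℤ₃ G (c ^₃_)
  ^₃-hom         c³≡ε 0₃ j = sym (identityˡ _)
  ^₃-hom {c = c} c³≡ε 1₃ j = trans (^₃-rot c³≡ε j) (cong (_∙ c ^₃ j) (sym (identityʳ c)))
  ^₃-hom {c = c} c³≡ε 2₃ j = begin
    c ^₃ rot₃ (rot₃ j)        ≡⟨ trans (^₃-rot c³≡ε (rot₃ j)) (cong (c ∙_) (^₃-rot c³≡ε j)) ⟩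
    c ∙ (c ∙ c ^₃ j)          ≡⟨ cong (c ∙_) (cong (_∙ c ^₃ j) (identityʳ c)) ⟨
    c ∙ (c ^₃ 1₃ ∙ c ^₃ j)    ≡⟨ assoc c (c ^₃ 1₃) (c ^₃ j) ⟨
    c ^₃ 2₃ ∙ c ^₃ j          ∎
    where open ≡-Reasoning

  -- c is recovered from a non-trivial power c ^₃ d as c ^₃ d itself or as its square.
  ^₃-generates : ∀ {c c' d} → c ^ 3 ≡ ε → c' ^ 3 ≡ ε → d ≢ 0₃ → c ^₃ d ∈⟨ c' ⟩ → c ∈⟨ c' ⟩
  ^₃-generates {d = 0₃} _ _ d≢0 _ = ⊥-elim (d≢0 refl)
  ^₃-generates {c} {d = 1₃} _ _ _ (e , c≡) = e , trans (sym (identityʳ c)) c≡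
  ^₃-generates {c} {c'} {2₃} c³≡ε c'³≡ε _ (e , c²≡) = e +₃ e , (begin
    c                   ≡⟨ identityʳ c ⟨
    c ^₃ (2₃ +₃ 2₃)     ≡⟨ ^₃-hom c³≡ε 2₃ 2₃ ⟩
    c ^₃ 2₃ ∙ c ^₃ 2₃   ≡⟨ cong₂ _∙_ c²≡ c²≡ ⟩
    c' ^₃ e ∙ c' ^₃ e   ≡⟨ ^₃-hom c'³≡ε e e ⟨
    c' ^₃ (e +₃ e)      ∎)
    where open ≡-Reasoning

  ^₃-kernel : ∀ {c} → c ^ 3 ≡ ε → c ≢ ε → ∀ i → c ^₃ i ≡ ε → i ≡ 0₃
  ^₃-kernel c³≡ε c≢ε i cⁱ≡ε with i Fin.≟ 0₃
  ... | yes i≡0 = i≡0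
  ... | no i≢0 with ^₃-generates c³≡ε (ε^ 3) i≢0 (0₃ , cⁱ≡ε)
  ...   | e , c≡εᵉ = ⊥-elim (c≢ε (trans c≡εᵉ (ε^ (toℕ e))))

  lagrange : ∀ S → Unique S → ε ∈ S → (∀ {x y} → x ∈ S → y ∈ S → x ∙ y ∈ S) →
             (∀ {x} → x ∈ S → x ⁻¹ ∈ S) → length S ∣ order
  lagrange S uS ε∈S ∙-closed ⁻¹-closed =
    Blocks.blocks-divide _≟_ {P = λ _ → ⊤} coset (length S)
      (λ {g} _ → Unique.map⁺ (∙-cancelˡ g _ _) uS) (λ {g} _ → List.length-map (g ∙_) S)
      coset-refl (λ _ → coset-sym) (λ _ _ → coset-trans)
      elements unique (All.tabulate _) (λ _ _ → complete _)
    where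
      coset : Carrier → List Carrier
      coset g = map (g ∙_) S

      coset-refl : ∀ g → g ∈ coset g
      coset-refl g = subst (_∈ coset g) (identityʳ g) (Membership.∈-map⁺ (g ∙_) ε∈S)

      coset-sym : ∀ {x y} → y ∈ coset x → x ∈ coset y
      coset-sym {x} y∈ with Membership.∈-map⁻ (x ∙_) y∈
      ... | s , s∈S , refl = subst (_∈ coset (x ∙ s)) (//-rightDividesʳ s x)
                                   (Membership.∈-map⁺ ((x ∙ s) ∙_) (⁻¹-closed s∈S))

      coset-trans : ∀ {x y u} → y ∈ coset x → u ∈ coset y → u ∈ coset x
      coset-trans {x} y∈ u∈ with Membership.∈-map⁻ (x ∙_) y∈
      ... | s , s∈S , refl with Membership.∈-map⁻ ((x ∙ s) ∙_) u∈
      ...   | t , t∈S , refl = subst (_∈ coset x) (sym (assoc x s t))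
                                     (Membership.∈-map⁺ (x ∙_) (∙-closed s∈S t∈S))

  -- McKay's rotation of the triples (x, y, (x ∙ y) ⁻¹) with product ε.
  rotate : Carrier × Carrier → Carrier × Carrier
  rotate (x , y) = y , (x ∙ y) ⁻¹

  private
    xy⁻¹-cancel : ∀ x y → (y ∙ (x ∙ y) ⁻¹) ⁻¹ ≡ x
    xy⁻¹-cancel x y = trans (cong _⁻¹ (inverseʳ-unique x _ (begin
      x ∙ (y ∙ (x ∙ y) ⁻¹)   ≡⟨ assoc x y _ ⟨
      (x ∙ y) ∙ (x ∙ y) ⁻¹   ≡⟨ inverseʳ (x ∙ y) ⟩
      ε                      ∎))) (⁻¹-involutive x)
      where open ≡-Reasoning

  rotate³≡id : ∀ p → rotate (rotate (rotate p)) ≡ p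
  rotate³≡id (x , y) = cong₂ _,_ (xy⁻¹-cancel x y) (begin
    ((x ∙ y) ⁻¹ ∙ (y ∙ (x ∙ y) ⁻¹) ⁻¹) ⁻¹   ≡⟨ cong (λ t → ((x ∙ y) ⁻¹ ∙ t) ⁻¹) (xy⁻¹-cancel x y) ⟩
    ((x ∙ y) ⁻¹ ∙ x) ⁻¹                     ≡⟨ cong (λ t → (t ⁻¹ ∙ x) ⁻¹) (comm x y) ⟩
    ((y ∙ x) ⁻¹ ∙ x) ⁻¹                     ≡⟨ cong _⁻¹ (comm _ x) ⟩
    (x ∙ (y ∙ x) ⁻¹) ⁻¹                     ≡⟨ xy⁻¹-cancel y x ⟩
    y                                       ∎)
    where open ≡-Reasoning

  rotate-ε : rotate (ε , ε) ≡ (ε , ε)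
  rotate-ε = cong (ε ,_) (trans (cong _⁻¹ (identityˡ ε)) ε⁻¹≈ε)

  rotate-fixed : ∀ {x y} → rotate (x , y) ≡ (x , y) → y ≡ x × x ^ 3 ≡ ε
  rotate-fixed {x} σp≡p with cong proj₁ σp≡p | cong proj₂ σp≡p
  ... | refl | xx⁻¹≡x = refl , (begin
    x ∙ (x ∙ (x ∙ ε))     ≡⟨ cong (λ t → x ∙ (x ∙ t)) (identityʳ x) ⟩
    x ∙ (x ∙ x)           ≡⟨ comm x _ ⟩
    (x ∙ x) ∙ x           ≡⟨ cong ((x ∙ x) ∙_) xx⁻¹≡x ⟨
    (x ∙ x) ∙ (x ∙ x) ⁻¹  ≡⟨ inverseʳ (x ∙ x) ⟩
    ε                     ∎)
    where open ≡-Reasoning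

  -- Without elements of order 3, (ε , ε) would be the only fixed point of rotate
  -- on the order ^ 2 pairs.
  cauchy₃ : 3 ∣ order → ∃ λ z → z ≢ ε × z ^ 3 ≡ ε
  cauchy₃ 3∣|G| with any? (λ x → ¬? (x ≟ ε) ×-dec (x ^ 3 ≟ ε)) elements
  ... | yes found = Any.satisfied found
  ... | no  none  = ⊥-elim (Orbits₃.one-fixed-point⇒3∤ (≡-dec _≟_ _≟_) rotate rotate³≡id pairs
                              (Unique.cartesianProduct⁺ unique unique) (∈pairs (ε , ε)) rotate-ε
                              (λ _ → ∈pairs _) (λ _ → fixed⇒ε) 3∣|pairs|)
    where
      pairs = cartesianProduct elements elements

      ∈pairs : ∀ p → p ∈ pairs
      ∈pairs (x , y) = Membership.∈-cartesianProduct⁺ (complete x) (complete y)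

      fixed⇒ε : ∀ {p} → rotate p ≡ p → p ≡ (ε , ε)
      fixed⇒ε {x , y} fixed with rotate-fixed fixed | x ≟ ε
      ... | refl , _   | yes refl = refl
      ... | refl , x³≡ε | no x≢ε   = ⊥-elim (none (Any.map (λ { refl → x≢ε , x³≡ε }) (complete x)))

      3∣|pairs| : 3 ∣ length pairs
      3∣|pairs| = subst (3 ∣_) (sym (length-cartesianProduct elements elements))
                        (∣-trans 3∣|G| (m∣m*n order))

module Hom {G K : FiniteAbelianGroup} {φ} (φ-∙ : IsHom G K φ) where
  private
    module G = FiniteAbelianGroup G
    module K = FiniteAbelianGroup K
    module GF = GroupFacts G
    module KF = GroupFacts K

  φ-ε : φ G.ε ≡ K.ε
  φ-ε = KF.∙-cancelˡ (φ G.ε) (φ G.ε) K.ε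
          (trans (sym (φ-∙ G.ε G.ε)) (trans (cong φ (GF.identityˡ G.ε)) (sym (KF.identityʳ _))))

  φ-⁻¹ : ∀ x → φ (x G.⁻¹) ≡ φ x K.⁻¹
  φ-⁻¹ x = KF.inverseʳ-unique (φ x) (φ (x G.⁻¹))
             (trans (sym (φ-∙ x (x G.⁻¹))) (trans (cong φ (GF.inverseʳ x)) φ-ε))

  φ-injective : (∀ x → φ x ≡ K.ε → x ≡ G.ε) → ∀ {x y} → φ x ≡ φ y → x ≡ y
  φ-injective kernel {x} {y} φx≡φy = GF.x∙y⁻¹≈ε⇒x≈y x y (kernel _ (begin
    φ (x G.∙ (y G.⁻¹))     ≡⟨ φ-∙ x (y G.⁻¹) ⟩
    φ x K.∙ φ (y G.⁻¹)     ≡⟨ cong₂ K._∙_ φx≡φy (φ-⁻¹ y) ⟩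
    φ y K.∙ (φ y K.⁻¹)     ≡⟨ KF.inverseʳ (φ y) ⟩
    K.ε                    ∎))
    where open ≡-Reasoning

module ThreeTorsion (G : FiniteAbelianGroup) where
  open FiniteAbelianGroup G hiding (_∙_; _⁻¹)
  open GroupFacts G

  -- For independent z and w of order 3, the products z ^₃ i ∙ w ^₃ j form a subgroup of order 9.
  module IndependentPair {z w} (z≢ε : z ≢ ε) (z³≡ε : z ^ 3 ≡ ε) (w³≡ε : w ^ 3 ≡ ε)
                         (w∉⟨z⟩ : ¬ w ∈⟨ z ⟩) where
    open ≡-Reasoning
    private module ℤ₃F = GroupFacts ℤ₃

    _+²_ : Fin 3 × Fin 3 → Fin 3 × Fin 3 → Fin 3 × Fin 3
    (i , j) +² (i' , j') = i +₃ i' , j +₃ j'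

    infix 25 -²_
    -²_ : Fin 3 × Fin 3 → Fin 3 × Fin 3
    -² (i , j) = -₃ i , -₃ j

    ψ : Fin 3 × Fin 3 → Carrier
    ψ (i , j) = z ^₃ i ∙ w ^₃ j

    ψ-hom : ∀ p q → ψ (p +² q) ≡ ψ p ∙ ψ q
    ψ-hom (i , j) (i' , j') =
      trans (cong₂ _∙_ (^₃-hom z³≡ε i i') (^₃-hom w³≡ε j j')) (interchange _ _ _ _)

    ψ-inverse : ∀ p → ψ (-² p) ≡ ψ p ⁻¹
    ψ-inverse p@(i , j) = inverseʳ-unique (ψ p) (ψ (-² p)) (begin
      ψ p ∙ ψ (-² p)   ≡⟨ ψ-hom p (-² p) ⟨
      ψ (p +² -² p)    ≡⟨ cong₂ (λ a b → ψ (a , b)) (+₃-inverseʳ i) (+₃-inverseʳ j) ⟩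
      ε ∙ ε            ≡⟨ identityˡ ε ⟩
      ε                ∎)

    ψ-kernel : ∀ p → ψ p ≡ ε → p ≡ (0₃ , 0₃)
    ψ-kernel (i , j) ψp≡ε with j Fin.≟ 0₃
    ... | yes refl = cong (_, 0₃) (^₃-kernel z³≡ε z≢ε i (trans (sym (identityʳ _)) ψp≡ε))
    ... | no  j≢0  = ⊥-elim (w∉⟨z⟩ (^₃-generates w³≡ε z³≡ε j≢0 (-₃ i , (begin
      w ^₃ j          ≡⟨ inverseʳ-unique (z ^₃ i) (w ^₃ j) ψp≡ε ⟩
      (z ^₃ i) ⁻¹     ≡⟨ Hom.φ-⁻¹ {ℤ₃} {G} (^₃-hom z³≡ε) i ⟨
      z ^₃ (-₃ i)     ∎))))

    ψ-injective : ∀ {p q} → ψ p ≡ ψ q → p ≡ q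
    ψ-injective {p@(i , j)} {q@(i' , j')} ψp≡ψq =
      cong₂ _,_ (ℤ₃F.x∙y⁻¹≈ε⇒x≈y i i' (cong proj₁ p-q≡0)) (ℤ₃F.x∙y⁻¹≈ε⇒x≈y j j' (cong proj₂ p-q≡0))
      where
        p-q≡0 = ψ-kernel (p +² -² q) (begin
          ψ (p +² -² q)    ≡⟨ ψ-hom p (-² q) ⟩
          ψ p ∙ ψ (-² q)   ≡⟨ cong₂ _∙_ ψp≡ψq (ψ-inverse q) ⟩
          ψ q ∙ ψ q ⁻¹     ≡⟨ inverseʳ (ψ q) ⟩
          ε                ∎)

    pairs₃ = cartesianProduct (allFin 3) (allFin 3)

    span : List Carrier
    span = map ψ pairs₃

    ψ∈span : ∀ p → ψ p ∈ span
    ψ∈span (i , j) = Membership.∈-map⁺ ψ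
      (Membership.∈-cartesianProduct⁺ (Membership.∈-allFin i) (Membership.∈-allFin j))

    9∣order : 9 ∣ order
    9∣order = lagrange span
      (Unique.map⁺ ψ-injective (Unique.cartesianProduct⁺ (Unique.allFin⁺ 3) (Unique.allFin⁺ 3)))
      (subst (_∈ span) (identityˡ ε) (ψ∈span (0₃ , 0₃)))
      (λ x∈ y∈ → ∙-closed (Membership.∈-map⁻ ψ {xs = pairs₃} x∈) (Membership.∈-map⁻ ψ {xs = pairs₃} y∈))
      (λ x∈ → ⁻¹-closed (Membership.∈-map⁻ ψ {xs = pairs₃} x∈))
      where
        ∙-closed : ∀ {x y} → ∃ (λ p → p ∈ pairs₃ × x ≡ ψ p) → ∃ (λ q → q ∈ pairs₃ × y ≡ ψ q) → x ∙ y ∈ span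
        ∙-closed (p , _ , refl) (q , _ , refl) = subst (_∈ span) (ψ-hom p q) (ψ∈span (p +² q))

        ⁻¹-closed : ∀ {x} → ∃ (λ p → p ∈ pairs₃ × x ≡ ψ p) → x ⁻¹ ∈ span
        ⁻¹-closed (p , _ , refl) = subst (_∈ span) (ψ-inverse p) (ψ∈span (-² p))

  3-torsion⊆⟨_⟩ : ∀ z → ¬ 9 ∣ order → z ≢ ε → z ^ 3 ≡ ε → ∀ {w} → w ^ 3 ≡ ε → w ∈⟨ z ⟩
  3-torsion⊆⟨ z ⟩ 9∤|G| z≢ε z³≡ε {w} w³≡ε with any? (λ i → w ≟ z ^₃ i) (allFin 3)
  ... | yes w∈⟨z⟩ = Any.satisfied w∈⟨z⟩
  ... | no  w∉⟨z⟩ = ⊥-elim (9∤|G| (IndependentPair.9∣order z≢ε z³≡ε w³≡ε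
                      (λ (i , w≡zⁱ) → w∉⟨z⟩ (Any.map (λ { refl → w≡zⁱ }) (Membership.∈-allFin i)))))

  -- The homomorphism is g ↦ g ^ m, which takes values in the 3-torsion ⟨ z ⟩ ≅ ℤ₃
  -- and fixes z because m ≡ 1 (mod 3).
  ℤ₃-quotient : ∀ q → order ≡ 3 ℕ.* (1 ℕ.+ q ℕ.* 3) → ∃ λ φ → IsHom G ℤ₃ φ × ∃ λ z → φ z ≡ 1₃
  ℤ₃-quotient q |G|≡3m with cauchy₃ (divides (1 ℕ.+ q ℕ.* 3) (trans |G|≡3m (ℕ.*-comm 3 _)))
  ... | z , z≢ε , z³≡ε = cls , cls-hom , z , cls-z
    where
      open ≡-Reasoning
      m = 1 ℕ.+ q ℕ.* 3

      9∤|G| : ¬ 9 ∣ order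
      9∤|G| 9∣|G| = toWitnessFalse {a? = 9 ∣? 3} _
        (∣m+n∣m⇒∣n (subst (9 ∣_) (trans |G|≡3m (3m≡ q)) 9∣|G|) (n∣m*n q))
        where
          3m≡ : ∀ q → 3 ℕ.* (1 ℕ.+ q ℕ.* 3) ≡ q ℕ.* 9 ℕ.+ 3
          3m≡ = ℕ-Solver.solve-∀

      class : ∀ g → g ^ m ∈⟨ z ⟩
      class g = 3-torsion⊆⟨ z ⟩ 9∤|G| z≢ε z³≡ε
                  (trans (^-* g m 3) (trans (cong (g ^_) (sym |G|≡3m)) (^-order g)))

      cls : Carrier → Fin 3
      cls = proj₁ ∘ class

      ^₃-injective : ∀ {i j} → z ^₃ i ≡ z ^₃ j → i ≡ j
      ^₃-injective = Hom.φ-injective {ℤ₃} {G} (^₃-hom z³≡ε) (^₃-kernel z³≡ε z≢ε)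

      cls-hom : IsHom G ℤ₃ cls
      cls-hom g h = ^₃-injective (begin
        z ^₃ cls (g ∙ h)          ≡⟨ proj₂ (class (g ∙ h)) ⟨
        (g ∙ h) ^ m               ≡⟨ ^-∙ g h m ⟩
        g ^ m ∙ h ^ m             ≡⟨ cong₂ _∙_ (proj₂ (class g)) (proj₂ (class h)) ⟩
        z ^₃ cls g ∙ z ^₃ cls h   ≡⟨ ^₃-hom z³≡ε (cls g) (cls h) ⟨
        z ^₃ (cls g +₃ cls h)     ∎)

      cls-z : cls z ≡ 1₃
      cls-z = ^₃-injective (begin
        z ^₃ cls z        ≡⟨ proj₂ (class z) ⟨
        z ∙ z ^ (q ℕ.* 3) ≡⟨ cong (z ∙_) (^-* z 3 q) ⟨
        z ∙ (z ^ 3) ^ q   ≡⟨ cong (λ c → z ∙ c ^ q) z³≡ε ⟩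
        z ∙ ε ^ q         ≡⟨ cong (z ∙_) (ε^ q) ⟩
        z ^₃ 1₃           ∎)

module GroupRingFacts (G : FiniteAbelianGroup) where
  open import Data.Integer using (_+_; _-_; _*_; -_)
  open FiniteAbelianGroup G
  open IntSum
  private module GF = GroupFacts G

  δ : Carrier → Carrier → ℤ
  δ x y = if does (x ≟ y) then + 1 else + 0

  δ-refl : ∀ x → δ x x ≡ + 1
  δ-refl x with x ≟ x
  ... | yes _   = refl
  ... | no x≢x = ⊥-elim (x≢x refl)

  δ-≢ : ∀ {x y} → x ≢ y → δ x y ≡ + 0
  δ-≢ {x} {y} x≢y with x ≟ y
  ... | yes x≡y = ⊥-elim (x≢y x≡y)
  ... | no  _   = refl

  δ-resp : ∀ {x y x' y'} → (x ≡ y → x' ≡ y') → (x' ≡ y' → x ≡ y) → δ x y ≡ δ x' y'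
  δ-resp {x} {y} {x'} {y'} to from with x ≟ y | x' ≟ y'
  ... | yes _   | yes _    = refl
  ... | no  _   | no  _    = refl
  ... | yes x≡y | no  x'≢y' = ⊥-elim (x'≢y' (to x≡y))
  ... | no  x≢y | yes x'≡y' = ⊥-elim (x≢y (from x'≡y'))

  δ-sym : ∀ x y → δ x y ≡ δ y x
  δ-sym x y = δ-resp sym sym

  sum-δ : ∀ x (f : Carrier → ℤ) → sumH (λ y → δ x y * f y) ≡ f x
  sum-δ x f = trans (sum-single unique (complete x) (λ y y≢x → cong (_* f y) (δ-≢ (y≢x ∘ sym))))
                    (trans (cong (_* f x) (δ-refl x)) (ℤ.*-identityˡ (f x)))

  δ-translate : ∀ a x y → δ (a ∙ x) (a ∙ y) ≡ δ x y
  δ-translate a x y = δ-resp (GF.∙-cancelˡ a x y) (cong (a ∙_))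

  δ-shift : ∀ a x y → δ (a ∙ x) y ≡ δ x ((a ⁻¹) ∙ y)
  δ-shift a x y = δ-resp (λ ax≡y → trans (sym (GF.\\-leftDividesʳ a x)) (cong ((a ⁻¹) ∙_) ax≡y))
                         (λ x≡a⁻¹y → trans (cong (a ∙_) x≡a⁻¹y) (GF.\\-leftDividesˡ a y))

  δ-⁻¹ : ∀ x y → δ (x ⁻¹) (y ⁻¹) ≡ δ x y
  δ-⁻¹ x y = δ-resp GF.⁻¹-injective (cong _⁻¹)

  if-then-0 : ∀ b (a : ℤ) → (if b then a else + 0) ≡ (if b then + 1 else + 0) * a
  if-then-0 true  a = sym (ℤ.*-identityˡ a)
  if-then-0 false a = refl

  -- The equations of the theorem for A = T₀, B = T₁ and S = H. The total S is a parameter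
  -- because pushing H forward does not give the element H of the target group.
  record Solution (n : ℕ) (S A B : GroupRing) : Set where
    field
      product : ∀ g → (A · B) g ≡ S g - eR g
      squares : ∀ g → (A · A) g + (B · B) g ≡ (+ 2) * S g - (A ⁽²⁾) g - (B ⁽²⁾) g + (+ 2) * (+ n) * eR g

module Pushforward {H K : FiniteAbelianGroup}
  (φ : FiniteAbelianGroup.Carrier H → FiniteAbelianGroup.Carrier K) where
  open import Data.Integer using (_+_; _-_; _*_; -_)
  private
    module H = FiniteAbelianGroup H
    module K = FiniteAbelianGroup K
  open GroupRingFacts K
  open IntSum
  open ≡-Reasoning
  open import Algebra.Properties.CommutativeSemigroup ℤ.*-commutativeSemigroup using (x∙yz≈y∙xz)

  push : H.GroupRing → K.GroupRing
  push A k = H.sumH (λ h → δ (φ h) k * A h)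

  sum-push : ∀ A (F : K.Carrier → ℤ) → K.sumH (λ k → push A k * F k) ≡ H.sumH (λ h → A h * F (φ h))
  sum-push A F = begin
    K.sumH (λ k → push A k * F k)
      ≡⟨ sum-cong K.elements (λ k → sym (sum-*ʳ (F k) H.elements (λ h → δ (φ h) k * A h))) ⟩
    K.sumH (λ k → H.sumH (λ h → δ (φ h) k * A h * F k))
      ≡⟨ sum-swap K.elements H.elements (λ k h → δ (φ h) k * A h * F k) ⟩
    H.sumH (λ h → K.sumH (λ k → δ (φ h) k * A h * F k))
      ≡⟨ sum-cong H.elements (λ h → trans (sum-cong K.elements (λ k → ℤ.*-assoc (δ (φ h) k) (A h) (F k)))
                                          (sum-δ (φ h) (λ k → A h * F k))) ⟩
    H.sumH (λ h → A h * F (φ h))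
      ∎

  push-cong : ∀ {A B} → (∀ g → A g ≡ B g) → ∀ k → push A k ≡ push B k
  push-cong A≗B k = sum-cong H.elements (λ h → cong (δ (φ h) k *_) (A≗B h))

  push-+ : ∀ A B k → push (λ g → A g + B g) k ≡ push A k + push B k
  push-+ A B k = trans (sum-cong H.elements (λ h → ℤ.*-distribˡ-+ (δ (φ h) k) (A h) (B h)))
                       (sum-distrib H.elements (λ h → δ (φ h) k * A h) (λ h → δ (φ h) k * B h))

  push-*ˡ : ∀ c A k → push (λ g → c * A g) k ≡ c * push A k
  push-*ˡ c A k = trans (sum-cong H.elements (λ h → x∙yz≈y∙xz (δ (φ h) k) c (A h)))
                        (sum-*ˡ c H.elements (λ h → δ (φ h) k * A h))

  push-minus : ∀ A B k → push (λ g → A g - B g) k ≡ push A k - push B k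
  push-minus A B k = trans (push-+ A (λ g → - B g) k) (cong (_+_ (push A k)) push-neg)
    where
      push-neg : push (λ g → - B g) k ≡ - push B k
      push-neg = trans (sum-cong H.elements (λ h → sym (ℤ.neg-distribʳ-* (δ (φ h) k) (B h))))
                       (sum-neg H.elements (λ h → δ (φ h) k * B h))

open Pushforward using (push)

push-∘ : ∀ {G H K : FiniteAbelianGroup} (φ : FiniteAbelianGroup.Carrier G → FiniteAbelianGroup.Carrier H)
         (ψ : FiniteAbelianGroup.Carrier H → FiniteAbelianGroup.Carrier K) A k →
         push {H} {K} ψ (push {G} {H} φ A) k ≡ push {G} {K} (ψ ∘ φ) A k
push-∘ {G} {H} {K} φ ψ A k =
  trans (sum-cong H.elements (λ c → ℤ.*-comm (δ (ψ c) k) _))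
        (trans (Pushforward.sum-push {G} {H} φ A (λ c → δ (ψ c) k))
               (sum-cong G.elements (λ g → ℤ.*-comm (A g) _)))
  where
    module G = FiniteAbelianGroup G
    module H = FiniteAbelianGroup H
    open GroupRingFacts K using (δ)
    open IntSum using (sum-cong)

push-≗ : ∀ {H K : FiniteAbelianGroup} {φ ψ : FiniteAbelianGroup.Carrier H → FiniteAbelianGroup.Carrier K} →
         (∀ h → φ h ≡ ψ h) → ∀ A k → push {H} {K} φ A k ≡ push {H} {K} ψ A k
push-≗ {H} {K} φ≗ψ A k =
  IntSum.sum-cong (FiniteAbelianGroup.elements H) (λ h → cong (λ c → δ c k ℤ.* A h) (φ≗ψ h))
  where open GroupRingFacts K using (δ)

⁽²⁾-as-push : ∀ {G : FiniteAbelianGroup} A g →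
              FiniteAbelianGroup._⁽²⁾ G A g ≡ push {G} {G} (λ h → FiniteAbelianGroup._∙_ G h h) A g
⁽²⁾-as-push {G} A g = IntSum.sum-cong elements (λ h → if-then-0 (does ((h ∙ h) ≟ g)) (A h))
  where
    open FiniteAbelianGroup G
    open GroupRingFacts G using (if-then-0)

module PushforwardHom {H K : FiniteAbelianGroup} {φ} (φ-∙ : IsHom H K φ) where
  open import Data.Integer using (_+_; _-_; _*_; -_)
  private
    module H = FiniteAbelianGroup H
    module K = FiniteAbelianGroup K
    module HF = GroupFacts H
    module HR = GroupRingFacts H
  open GroupRingFacts K
  open Pushforward {H} {K} φ public renaming (push to φ*)
  open Hom {H} {K} φ-∙ using (φ-ε; φ-⁻¹)
  open IntSum
  open ≡-Reasoning
  open import Algebra.Properties.CommutativeSemigroup ℤ.*-commutativeSemigroup using (x∙yz≈y∙xz)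

  push-· : ∀ A B k → φ* (A H.· B) k ≡ (φ* A K.· φ* B) k
  push-· A B k = begin
    φ* (A H.· B) k
      ≡⟨ sum-cong H.elements (λ g → sym (sum-*ˡ (δ (φ g) k) H.elements (λ h → A h * B (h ⁻¹∙ g)))) ⟩
    H.sumH (λ g → H.sumH (λ h → δ (φ g) k * (A h * B (h ⁻¹∙ g))))
      ≡⟨ sum-swap H.elements H.elements (λ g h → δ (φ g) k * (A h * B (h ⁻¹∙ g))) ⟩
    H.sumH (λ h → H.sumH (λ g → δ (φ g) k * (A h * B (h ⁻¹∙ g))))
      ≡⟨ sum-cong H.elements (λ h → trans (sum-cong H.elements (λ g → x∙yz≈y∙xz (δ (φ g) k) (A h) _))
                                          (sum-*ˡ (A h) H.elements (λ g → δ (φ g) k * B (h ⁻¹∙ g)))) ⟩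
    H.sumH (λ h → A h * H.sumH (λ g → δ (φ g) k * B (h ⁻¹∙ g)))
      ≡⟨ sum-cong H.elements (λ h → cong (A h *_) (translate h)) ⟩
    H.sumH (λ h → A h * φ* B ((φ h K.⁻¹) K.∙ k))
      ≡⟨ sum-push A (λ c → φ* B ((c K.⁻¹) K.∙ k)) ⟨
    (φ* A K.· φ* B) k
      ∎
    where
      _⁻¹∙_ : H.Carrier → H.Carrier → H.Carrier
      h ⁻¹∙ g = (h H.⁻¹) H.∙ g

      translate : ∀ h → H.sumH (λ g → δ (φ g) k * B (h ⁻¹∙ g)) ≡ φ* B ((φ h K.⁻¹) K.∙ k)
      translate h = trans
        (sym (sum-reindex H.unique H.complete (h H.∙_) (h ⁻¹∙_)
                          (HF.\\-leftDividesʳ h) (HF.\\-leftDividesˡ h) (λ g → δ (φ g) k * B (h ⁻¹∙ g))))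
        (sum-cong H.elements (λ g → cong₂ _*_
          (trans (cong (λ c → δ c k) (φ-∙ h g)) (δ-shift (φ h) (φ g) k))
          (cong B (HF.\\-leftDividesʳ h g))))

  push-⁽²⁾ : ∀ A k → φ* (A H.⁽²⁾) k ≡ (φ* A K.⁽²⁾) k
  push-⁽²⁾ A k = begin
    φ* (A H.⁽²⁾) k                            ≡⟨ push-cong (⁽²⁾-as-push {H} A) k ⟩
    φ* (push {H} {H} (λ h → h H.∙ h) A) k     ≡⟨ push-∘ {H} {H} {K} (λ h → h H.∙ h) φ A k ⟩
    push {H} {K} (λ h → φ (h H.∙ h)) A k      ≡⟨ push-≗ {H} {K} (λ h → φ-∙ h h) A k ⟩
    push {H} {K} (λ h → φ h K.∙ φ h) A k      ≡⟨ push-∘ {H} {K} {K} φ (λ c → c K.∙ c) A k ⟨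
    push {K} {K} (λ c → c K.∙ c) (φ* A) k     ≡⟨ ⁽²⁾-as-push {K} (φ* A) k ⟨
    (φ* A K.⁽²⁾) k                            ∎

  push-e : ∀ k → φ* H.eR k ≡ K.eR k
  push-e k = begin
    H.sumH (λ h → δ (φ h) k * HR.δ h H.ε)   ≡⟨ sum-cong H.elements (λ h → trans (ℤ.*-comm (δ (φ h) k) _)
                                                    (cong (_* δ (φ h) k) (HR.δ-sym h H.ε))) ⟩
    H.sumH (λ h → HR.δ H.ε h * δ (φ h) k)   ≡⟨ HR.sum-δ H.ε (λ h → δ (φ h) k) ⟩
    δ (φ H.ε) k                             ≡⟨ cong (λ c → δ c k) φ-ε ⟩
    δ K.ε k                                 ≡⟨ δ-sym K.ε k ⟩
    K.eR k                                  ∎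

  push-⁻¹ : ∀ A → (∀ g → A (g H.⁻¹) ≡ A g) → ∀ k → φ* A (k K.⁻¹) ≡ φ* A k
  push-⁻¹ A A-sym k =
    trans (sym (sum-reindex H.unique H.complete H._⁻¹ H._⁻¹ HF.⁻¹-involutive HF.⁻¹-involutive
                            (λ h → δ (φ h) (k K.⁻¹) * A h)))
          (sum-cong H.elements (λ h → cong₂ _*_
            (trans (cong (λ c → δ c (k K.⁻¹)) (φ-⁻¹ h)) (δ-⁻¹ (φ h) k))
            (A-sym h)))

  push-translate : ∀ A a → (∀ g → A (a H.∙ g) ≡ A g) → ∀ k → φ* A (φ a K.∙ k) ≡ φ* A k
  push-translate A a A-inv k =
    trans (sym (sum-reindex H.unique H.complete (a H.∙_) ((a H.⁻¹) H.∙_)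
                            (HF.\\-leftDividesʳ a) (HF.\\-leftDividesˡ a)
                            (λ h → δ (φ h) (φ a K.∙ k) * A h)))
          (sum-cong H.elements (λ h → cong₂ _*_
            (trans (cong (λ c → δ c (φ a K.∙ k)) (φ-∙ a h)) (δ-translate (φ a) (φ h) k))
            (A-inv h)))

  push-solution : ∀ {n S A B} → HR.Solution n S A B → Solution n (φ* S) (φ* A) (φ* B)
  push-solution {n} {S} {A} {B} record { product = eq₁ ; squares = eq₂ } =
    record { product = eq₁′ ; squares = eq₂′ }
    where
      eq₁′ : ∀ k → (φ* A K.· φ* B) k ≡ φ* S k - K.eR k
      eq₁′ k = begin
        (φ* A K.· φ* B) k           ≡⟨ push-· A B k ⟨
        φ* (A H.· B) k              ≡⟨ push-cong eq₁ k ⟩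
        φ* (λ g → S g - H.eR g) k   ≡⟨ push-minus S H.eR k ⟩
        φ* S k - φ* H.eR k          ≡⟨ cong (_-_ (φ* S k)) (push-e k) ⟩
        φ* S k - K.eR k             ∎

      eq₂′ : ∀ k → (φ* A K.· φ* A) k + (φ* B K.· φ* B) k
                   ≡ (+ 2) * φ* S k - (φ* A K.⁽²⁾) k - (φ* B K.⁽²⁾) k + (+ 2) * (+ n) * K.eR k
      eq₂′ k = begin
        (φ* A K.· φ* A) k + (φ* B K.· φ* B) k
          ≡⟨ cong₂ _+_ (push-· A A k) (push-· B B k) ⟨
        φ* (A H.· A) k + φ* (B H.· B) k
          ≡⟨ push-+ (A H.· A) (B H.· B) k ⟨
        φ* (λ g → (A H.· A) g + (B H.· B) g) k
          ≡⟨ push-cong eq₂ k ⟩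
        φ* (λ g → (+ 2) * S g - (A H.⁽²⁾) g - (B H.⁽²⁾) g + (+ 2) * (+ n) * H.eR g) k
          ≡⟨ push-+ (λ g → (+ 2) * S g - (A H.⁽²⁾) g - (B H.⁽²⁾) g) (λ g → (+ 2) * (+ n) * H.eR g) k ⟩
        φ* (λ g → (+ 2) * S g - (A H.⁽²⁾) g - (B H.⁽²⁾) g) k + φ* (λ g → (+ 2) * (+ n) * H.eR g) k
          ≡⟨ cong₂ _+_
               (trans (push-minus (λ g → (+ 2) * S g - (A H.⁽²⁾) g) (B H.⁽²⁾) k)
                      (cong₂ _-_ (trans (push-minus (λ g → (+ 2) * S g) (A H.⁽²⁾) k)
                                        (cong₂ _-_ (push-*ˡ (+ 2) S k) (push-⁽²⁾ A k)))
                                 (push-⁽²⁾ B k)))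
               (trans (push-*ˡ ((+ 2) * (+ n)) H.eR k) (cong ((+ 2) * (+ n) *_) (push-e k))) ⟩
        (+ 2) * φ* S k - (φ* A K.⁽²⁾) k - (φ* B K.⁽²⁾) k + (+ 2) * (+ n) * K.eR k
          ∎

module _ where
  open import Data.Integer using (_+_; _-_; _*_; -_)

  ∣u∣≡1⇒u≡±1 : ∀ u → ∣ u ∣ ≡ 1 → u ≡ + 1 ⊎ u ≡ -1ℤ
  ∣u∣≡1⇒u≡±1 (+ .1)        refl = inj₁ refl
  ∣u∣≡1⇒u≡±1 -[1+ zero ]  _    = inj₂ refl
  ∣u∣≡1⇒u≡±1 -[1+ suc _ ] ()

  2≡2n⇒n≡1 : ∀ {n} → + 2 ≡ + 0 + (+ 2) * (+ n) → n ≡ 1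
  2≡2n⇒n≡1 {n} eq =
    ℕ.*-cancelˡ-≡ n 1 2 (sym (ℤ.+-injective (trans eq (trans (ℤ.+-identityˡ _) (sym (ℤ.pos-* 2 n))))))

  -- u v = -1 forces {u, v} = {1, -1}, so the second equation reads 2 = 2 n.
  unit-product⇒n≡1 : ∀ u v n → u * v ≡ -1ℤ → u * u + v * v ≡ - u - v + (+ 2) * (+ n) → n ≡ 1
  unit-product⇒n≡1 u v n uv≡-1 sq≡
    with ∣u∣≡1⇒u≡±1 u (ℕ.m*n≡1⇒m≡1 ∣ u ∣ ∣ v ∣ (trans (sym (ℤ.abs-* u v)) (cong ∣_∣ uv≡-1)))
  ... | inj₁ refl with refl ← trans (sym (ℤ.*-identityˡ v)) uv≡-1 = 2≡2n⇒n≡1 sq≡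
  ... | inj₂ refl with refl ← ℤ.neg-injective (trans (sym (ℤ.-1*i≡-i v)) uv≡-1) = 2≡2n⇒n≡1 sq≡

  -- The coefficients at 0₃ and 1₃ of the two equations in ℤ[ℤ₃], as the sums over ℤ₃ compute
  -- them, for x = x₀ + x₁ (ω + ω²), y = y₀ + y₁ (ω + ω²) and s = s₀ (1 + ω + ω²).
  -- Subtracting them isolates u = x₀ - x₁ and v = y₀ - y₁.
  ℤ₃-coefficients⇒n≡1 : ∀ {x₀ x₁ x₂ y₀ y₁ y₂ s₀ s₁} n → x₁ ≡ x₂ → y₁ ≡ y₂ → s₁ ≡ s₀ →
    x₀ * y₀ + (x₁ * y₂ + (x₂ * y₁ + + 0)) ≡ s₀ - + 1 →
    x₀ * y₁ + (x₁ * y₀ + (x₂ * y₂ + + 0)) ≡ s₁ - + 0 →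
    x₀ * x₀ + (x₁ * x₂ + (x₂ * x₁ + + 0)) + (y₀ * y₀ + (y₁ * y₂ + (y₂ * y₁ + + 0)))
      ≡ (+ 2) * s₀ - (x₀ + (+ 0 + (+ 0 + + 0))) - (y₀ + (+ 0 + (+ 0 + + 0))) + (+ 2) * (+ n) * + 1 →
    x₀ * x₁ + (x₁ * x₀ + (x₂ * x₂ + + 0)) + (y₀ * y₁ + (y₁ * y₀ + (y₂ * y₂ + + 0)))
      ≡ (+ 2) * s₁ - (+ 0 + (+ 0 + (x₂ + + 0))) - (+ 0 + (+ 0 + (y₂ + + 0))) + (+ 2) * (+ n) * + 0 →
    n ≡ 1
  ℤ₃-coefficients⇒n≡1 {x₀} {x₁} {_} {y₀} {y₁} {_} {s} n refl refl refl c₀ c₁ d₀ d₁ =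
    unit-product⇒n≡1 (x₀ - x₁) (y₀ - y₁) n
      (trans (product≡ x₀ x₁ y₀ y₁) (trans (cong₂ _-_ c₀ c₁) (difference≡ s)))
      (trans (squares≡ x₀ x₁ y₀ y₁) (trans (cong₂ _-_ d₀ d₁) (rhs-difference≡ x₀ x₁ y₀ y₁ s (+ n))))
    where
      product≡ : ∀ x₀ x₁ y₀ y₁ → (x₀ - x₁) * (y₀ - y₁)
                 ≡ x₀ * y₀ + (x₁ * y₁ + (x₁ * y₁ + + 0)) - (x₀ * y₁ + (x₁ * y₀ + (x₁ * y₁ + + 0)))
      product≡ = solve-∀

      difference≡ : ∀ s → s - + 1 - (s - + 0) ≡ -1ℤ
      difference≡ = solve-∀

      squares≡ : ∀ x₀ x₁ y₀ y₁ → (x₀ - x₁) * (x₀ - x₁) + (y₀ - y₁) * (y₀ - y₁)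
                 ≡ x₀ * x₀ + (x₁ * x₁ + (x₁ * x₁ + + 0)) + (y₀ * y₀ + (y₁ * y₁ + (y₁ * y₁ + + 0)))
                   - (x₀ * x₁ + (x₁ * x₀ + (x₁ * x₁ + + 0)) + (y₀ * y₁ + (y₁ * y₀ + (y₁ * y₁ + + 0))))
      squares≡ = solve-∀

      rhs-difference≡ : ∀ x₀ x₁ y₀ y₁ s m →
        (+ 2) * s - (x₀ + (+ 0 + (+ 0 + + 0))) - (y₀ + (+ 0 + (+ 0 + + 0))) + (+ 2) * m * + 1
        - ((+ 2) * s - (+ 0 + (+ 0 + (x₁ + + 0))) - (+ 0 + (+ 0 + (y₁ + + 0))) + (+ 2) * m * + 0)
        ≡ - (x₀ - x₁) - (y₀ - y₁) + (+ 2) * m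
      rhs-difference≡ = solve-∀

ℤ₃-solution⇒n≡1 : ∀ {n s x y} → GroupRingFacts.Solution ℤ₃ n s x y →
                  x 1₃ ≡ x 2₃ → y 1₃ ≡ y 2₃ → s 1₃ ≡ s 0₃ → n ≡ 1
ℤ₃-solution⇒n≡1 {n} {s} {x} {y} record { product = eq₁ ; squares = eq₂ } x₁≡x₂ y₁≡y₂ s₁≡s₀ =
  ℤ₃-coefficients⇒n≡1 {x 0₃} {x 1₃} {x 2₃} {y 0₃} {y 1₃} {y 2₃} {s 0₃} {s 1₃} n
    x₁≡x₂ y₁≡y₂ s₁≡s₀ (eq₁ 0₃) (eq₁ 1₃) (eq₂ 0₃) (eq₂ 1₃)

solution⇒n≡1 : ∀ (H : FiniteAbelianGroup) {φ} → IsHom H ℤ₃ φ → ∀ {z} → φ z ≡ 1₃ →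
  let open FiniteAbelianGroup H in
  ∀ {n T₀ T₁} → InverseClosed T₀ → InverseClosed T₁ →
  GroupRingFacts.Solution H n HR ⟦ T₀ ⟧ ⟦ T₁ ⟧ → n ≡ 1
solution⇒n≡1 H {φ} φ-∙ {z} φz≡1 {T₀ = T₀} {T₁} T₀⁻¹ T₁⁻¹ solution =
  ℤ₃-solution⇒n≡1 (push-solution solution)
    (sym (push-⁻¹ ⟦ T₀ ⟧ (⟦⟧-⁻¹ T₀⁻¹) 1₃)) (sym (push-⁻¹ ⟦ T₁ ⟧ (⟦⟧-⁻¹ T₁⁻¹) 1₃))
    (trans (cong (λ c → φ* HR (c +₃ 0₃)) (sym φz≡1)) (push-translate HR z (λ _ → refl) 0₃))
  where
    open FiniteAbelianGroup H
    open PushforwardHom {H} {ℤ₃} {φ} φ-∙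

    ⟦⟧-⁻¹ : ∀ {T} → InverseClosed T → ∀ g → ⟦ T ⟧ (g ⁻¹) ≡ ⟦ T ⟧ g
    ⟦⟧-⁻¹ T⁻¹ g = cong (λ b → if b then + 1 else + 0) (T⁻¹ g)

n²+n+1≡3[1+3q] : ∀ n → n % 6 ≡ 1 → ∃ λ q → n ℕ.* n ℕ.+ n ℕ.+ 1 ≡ 3 ℕ.* (1 ℕ.+ q ℕ.* 3)
n²+n+1≡3[1+3q] n n%6≡1 =
  2 ℕ.* t ℕ.+ 4 ℕ.* t ℕ.* t , trans (cong (λ k → k ℕ.* k ℕ.+ k ℕ.+ 1) n≡1+6t) (expand t)
  where
    t = n / 6
    n≡1+6t : n ≡ 1 ℕ.+ t ℕ.* 6
    n≡1+6t = trans (m≡m%n+[m/n]*n n 6) (cong (ℕ._+ t ℕ.* 6) n%6≡1)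
    expand : ∀ t → (1 ℕ.+ t ℕ.* 6) ℕ.* (1 ℕ.+ t ℕ.* 6) ℕ.+ (1 ℕ.+ t ℕ.* 6) ℕ.+ 1
                   ≡ 3 ℕ.* (1 ℕ.+ (2 ℕ.* t ℕ.+ 4 ℕ.* t ℕ.* t) ℕ.* 3)
    expand = ℕ-Solver.solve-∀

open import Data.Nat using (_+_; _*_)

proposition7p1 : (n : ℕ) → n > 0 → (n % 5 ≡ 0 ⊎ n % 5 ≡ 3) → n % 6 ≡ 1 →
    (H : FiniteAbelianGroup) → FiniteAbelianGroup.order H ≡ n * n + n + 1 →
    let open FiniteAbelianGroup H in
    ¬ (Σ Subset λ T₀ → Σ Subset λ T₁ →
         InverseClosed T₀ × InverseClosed T₁ × T₀ ε ≡ true ×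
         (∀ g → (⟦ T₀ ⟧ · ⟦ T₁ ⟧) g ≡ HR g ℤ.- eR g) ×
         (∀ g → (⟦ T₀ ⟧ · ⟦ T₀ ⟧) g ℤ.+ (⟦ T₁ ⟧ · ⟦ T₁ ⟧) g
                ≡ (+ 2) ℤ.* HR g ℤ.- (⟦ T₀ ⟧ ⁽²⁾) g ℤ.- (⟦ T₁ ⟧ ⁽²⁾) g
                  ℤ.+ (+ 2) ℤ.* (+ n) ℤ.* eR g))
proposition7p1 n _ n%5≡0⊎3 n%6≡1 H |H|≡ (T₀ , T₁ , T₀⁻¹ , T₁⁻¹ , _ , product , squares) =
  let q , |H|≡3[1+3q] = n²+n+1≡3[1+3q] n n%6≡1
      φ , φ-∙ , z , φz≡1 = ThreeTorsion.ℤ₃-quotient H q (trans |H|≡ |H|≡3[1+3q])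
      n≡1 = solution⇒n≡1 H {φ} φ-∙ {z} φz≡1 {n} {T₀} {T₁} T₀⁻¹ T₁⁻¹
              record { product = product ; squares = squares }
  in 1%5≢0⊎3 (subst (λ m → m % 5 ≡ 0 ⊎ m % 5 ≡ 3) n≡1 n%5≡0⊎3)
  where
    1%5≢0⊎3 : ¬ (1 % 5 ≡ 0 ⊎ 1 % 5 ≡ 3)
    1%5≢0⊎3 (inj₁ ())
    1%5≢0⊎3 (inj₂ ())
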